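{- For every integer $n \geq 4$, $M'_D(K_{n,n}) \leq 3$.
   Context: $K_{n,n}$ is the complete bipartite graph with both parts of size $n$. A majority edge coloring is an edge coloring such that for every vertex $u$ and every color $\alpha$, at most half of the edges incident with $u$ have color $\alpha$. It is distinguishing if the only automorphism $\varphi$ of the graph with $c(\varphi(u)\varphi(v))=c(uv)$ for all edges $uv$ is the identity. $M'_D(G)$ is the least number of colors in an edge coloring of $G$ that is both majority and distinguishing. -}

module Defs where

open import Data.Nat using (ℕ; _*_; _≤_)
open import Data.Fin using (Fin)
open import Data.Fin.Properties using (_≟_)
open import Data.Sum using (_⊎_; inj₁; inj₂)
open import Data.List using (List; length; filter)
open import Data.List.Base using (allFin)
open import Function.Bundles using (_↔_; Inverse)
open import Relation.Binary.PropositionalEquality using (_≡_)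

-- The complete bipartite graph K_{n,n}:
-- vertices are  Fin n ⊎ Fin n  (left part inj₁, right part inj₂),
-- u and v are adjacent iff they lie in different parts.
Vertex : ℕ → Set
Vertex n = Fin n ⊎ Fin n

data Adj {n : ℕ} : Vertex n → Vertex n → Set where
  lr : (i j : Fin n) → Adj (inj₁ i) (inj₂ j)
  rl : (i j : Fin n) → Adj (inj₂ j) (inj₁ i)

-- An edge colouring of K_{n,n} with k colours: the edge {left i, right j}
-- gets colour c i j.  (Every edge is exactly one such pair.)
EdgeColoring : ℕ → ℕ → Set
EdgeColoring n k = Fin n → Fin n → Fin k

colorOf : ∀ {n k} → EdgeColoring n k → (u v : Vertex n) → Adj u v → Fin k
colorOf c .(inj₁ i) .(inj₂ j) (lr i j) = c i j
colorOf c .(inj₂ j) .(inj₁ i) (rl i j) = c i j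

degColor : ∀ {n k} → EdgeColoring n k → Vertex n → Fin k → ℕ
degColor {n} c (inj₁ i) α = length (filter (λ j → c i j ≟ α) (allFin n))
degColor {n} c (inj₂ j) α = length (filter (λ i → c i j ≟ α) (allFin n))

IsMajority : ∀ {n k} → EdgeColoring n k → Set
IsMajority {n} {k} c = (u : Vertex n) (α : Fin k) → 2 * degColor c u α ≤ n

record Automorphism (n : ℕ) : Set where
  field
    perm : Vertex n ↔ Vertex n
  φ : Vertex n → Vertex n
  φ = Inverse.to perm
  field
    preserves : ∀ {u v} → Adj u v → Adj (φ u) (φ v)
    reflects  : ∀ {u v} → Adj (φ u) (φ v) → Adj u v

PreservesColoring : ∀ {n k} → EdgeColoring n k → Automorphism n → Set
PreservesColoring {n} c a =
  ∀ (u v : Vertex n) (e : Adj u v) →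
    colorOf c (φ u) (φ v) (preserves e) ≡ colorOf c u v e
  where open Automorphism a

IsDistinguishing : ∀ {n k} → EdgeColoring n k → Set
IsDistinguishing {n} c =
  (a : Automorphism n) → PreservesColoring c a →
    ∀ (u : Vertex n) → Automorphism.φ a u ≡ u

-- Colour the edge L_i R_j with 2 when j ∈ {i, i + 1}, with 1 for the single twisted edge L₀R₂,
-- and with the parity of i + j otherwise.
-- The colour-2 edges form the Hamiltonian path R₀ L₀ R₁ L₁ ⋯ R_{n-1} L_{n-1}, so a colour-preserving
-- automorphism restricts to an automorphism of this path and sends the end R₀ to an end. If it
-- fixes R₀ it fixes the whole path; otherwise it is the reversal L_i ↔ R_{n-1-i}, which for n ≥ 4
-- maps the twisted edge to L_{n-3}R_{n-1}, an edge of colour 0.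
-- Around every vertex the colours form an alternating 0/1 sequence in which the path edges replace
-- a 0 and a 1 by 2 and the twisted edge turns a 0 into a 1. A colour filling more than half of the
-- alternating sequence always loses an occurrence this way, so no colour class exceeds n/2; colour 2
-- occurs at most twice.
module Submission where

open import Defs
open import Data.Nat.Base using (ℕ; zero; suc; _+_; _*_; _∸_; _≤_; _<_; z≤n; s≤s)
open import Data.Product.Base using (Σ; _×_; _,_)

open import Data.Nat.Properties
open import Algebra.Properties.CommutativeMonoid.Sum +-0-commutativeMonoid
  using (sum; sum-syntax; sum-cong-≗; ∑-distrib-+)
open import Data.Bool.Base using (true; false)
open import Data.Empty using (⊥-elim)
open import Data.Fin.Base using (Fin; toℕ; inject₁; opposite) renaming (zero to fzero; suc to fsuc)
open import Data.Fin.Patterns using (0F; 1F; 2F)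
import Data.Fin.Properties as Fin
open import Data.List.Base using (length; filter; tabulate)
open import Data.Nat.Tactic.RingSolver using (solve-∀)
open import Data.Sum.Base using (_⊎_; inj₁; inj₂; [_,_]; swap)
open import Function.Base using (_∘_; id)
open import Function.Bundles using (_⇔_; mk⇔; Equivalence; Inverse; Injection)
import Function.Properties.Equivalence as ⇔
open import Function.Properties.Inverse using (↔⇒↣)
open import Level using (Level)
open import Relation.Binary.PropositionalEquality
  using (_≡_; _≢_; refl; sym; trans; cong; cong₂; subst; module ≡-Reasoning)
open import Relation.Nullary.Decidable using (Dec; yes; no; _because_; _×-dec_)
open import Relation.Nullary.Negation using (¬_; contradiction)
open import Relation.Unary using (Pred; Decidable)

𝟙 : ∀ {a} {A : Set a} → Dec A → ℕ
𝟙 (true because _) = 1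
𝟙 (false because _) = 0

𝟙≤1 : ∀ {a} {A : Set a} (a? : Dec A) → 𝟙 a? ≤ 1
𝟙≤1 (true because _) = s≤s z≤n
𝟙≤1 (false because _) = z≤n

𝟙-yes : ∀ {a} {A : Set a} (a? : Dec A) → A → 𝟙 a? ≡ 1
𝟙-yes (yes _) _ = refl
𝟙-yes (no ¬x) x = contradiction x ¬x

𝟙-no : ∀ {a} {A : Set a} (a? : Dec A) → ¬ A → 𝟙 a? ≡ 0
𝟙-no (yes x) ¬x = contradiction x ¬x
𝟙-no (no _) _ = refl

∑-mono-≤ : ∀ {n} {f g : Fin n → ℕ} → (∀ t → f t ≤ g t) → sum f ≤ sum g
∑-mono-≤ {zero} f≤g = z≤n
∑-mono-≤ {suc n} f≤g = +-mono-≤ (f≤g fzero) (∑-mono-≤ (f≤g ∘ fsuc))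

∑-mono-+ : ∀ {n} {f g h k : Fin n → ℕ} → (∀ t → f t + g t ≤ h t + k t) →
           sum f + sum g ≤ sum h + sum k
∑-mono-+ {f = f} {g} {h} {k} le = begin
  sum f + sum g           ≡⟨ ∑-distrib-+ f g ⟨
  sum (λ t → f t + g t)   ≤⟨ ∑-mono-≤ le ⟩
  sum (λ t → h t + k t)   ≡⟨ ∑-distrib-+ h k ⟩
  sum h + sum k           ∎
  where open ≤-Reasoning

∑-mono-+ˡ : ∀ {n} {f g h : Fin n → ℕ} → (∀ t → f t + g t ≤ h t) → sum f + sum g ≤ sum h
∑-mono-+ˡ {f = f} {g} le = ≤-trans (≤-reflexive (sym (∑-distrib-+ f g))) (∑-mono-≤ le)

∑-mono-+ʳ : ∀ {n} {f g h : Fin n → ℕ} → (∀ t → f t ≤ g t + h t) → sum f ≤ sum g + sum h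
∑-mono-+ʳ {g = g} {h} le = ≤-trans (∑-mono-≤ le) (≤-reflexive (∑-distrib-+ g h))

term≤sum : ∀ {n} (f : Fin n → ℕ) t → f t ≤ sum f
term≤sum f fzero = m≤m+n _ _
term≤sum f (fsuc t) = ≤-trans (term≤sum (f ∘ fsuc) t) (m≤n+m _ _)

count : ∀ n {p} {P : Pred (Fin n) p} → Decidable P → ℕ
count n P? = ∑[ t < n ] 𝟙 (P? t)

module _ {p : Level} where

  count-none : ∀ n {P : Pred (Fin n) p} (P? : Decidable P) → (∀ t → ¬ P t) → count n P? ≡ 0
  count-none zero P? ¬P = refl
  count-none (suc n) P? ¬P =
    cong₂ _+_ (𝟙-no (P? fzero) (¬P fzero)) (count-none n (P? ∘ fsuc) (¬P ∘ fsuc))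

  count-unique : ∀ n {P : Pred (Fin n) p} (P? : Decidable P) →
                 (∀ {s t} → P s → P t → s ≡ t) → count n P? ≤ 1
  count-unique zero P? unique = z≤n
  count-unique (suc n) P? unique with P? fzero
  ... | yes P0 = ≤-reflexive (cong suc (count-none n (P? ∘ fsuc) λ t Pt → Fin.0≢1+n (unique P0 Pt)))
  ... | no _   = count-unique n (P? ∘ fsuc) (λ Ps Pt → Fin.suc-injective (unique Ps Pt))

  count-pinned : ∀ n {P : Pred (Fin n) p} (P? : Decidable P) c →
                 (∀ {t} → P t → toℕ t ≡ c) → count n P? ≤ 1
  count-pinned n P? c pin = count-unique n P? λ Ps Pt → Fin.toℕ-injective (trans (pin Ps) (sym (pin Pt)))

  count-some : ∀ n {P : Pred (Fin n) p} (P? : Decidable P) {t} → P t → 1 ≤ count n P?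
  count-some n P? {t} Pt = ≤-trans (≤-reflexive (sym (𝟙-yes (P? t) Pt))) (term≤sum (λ t → 𝟙 (P? t)) t)

count-index : ∀ n {a} → a < n → 1 ≤ count n (λ t → toℕ t ≟ a)
count-index n a<n = count-some n (λ t → toℕ t ≟ _) (Fin.toℕ-fromℕ< a<n)

length-filter-tabulate : ∀ {a p} {A : Set a} {P : Pred A p} (P? : Decidable P) {n} (f : Fin n → A) →
                         length (filter P? (tabulate f)) ≡ count n (P? ∘ f)
length-filter-tabulate P? {zero} f = refl
length-filter-tabulate P? {suc n} f with P? (f fzero)
... | yes _ = cong suc (length-filter-tabulate P? (f ∘ fsuc))
... | no _  = length-filter-tabulate P? (f ∘ fsuc)

twice≤-by-loss : ∀ {n x y} → x + 1 ≤ y → 2 * y ≤ suc n → 2 * x ≤ n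
twice≤-by-loss {n} {x} {y} x+1≤y 2y≤1+n = ≤-pred (begin-strict
  2 * x       <⟨ n<1+n _ ⟩
  suc (2 * x) ≤⟨ n≤1+n _ ⟩
  2 + 2 * x   ≡⟨ *-suc 2 x ⟨
  2 * suc x   ≡⟨ cong (2 *_) (+-comm 1 x) ⟩
  2 * (x + 1) ≤⟨ *-monoʳ-≤ 2 x+1≤y ⟩
  2 * y       ≤⟨ 2y≤1+n ⟩
  suc n       ∎)
  where open ≤-Reasoning

twice≤-by-≤ : ∀ {n x y} → x ≤ y → 2 * y ≤ n → 2 * x ≤ n
twice≤-by-≤ x≤y 2y≤n = ≤-trans (*-monoʳ-≤ 2 x≤y) 2y≤n

no-gain : ∀ {x y d s} → x + d ≤ y + s → s ≤ d → x ≤ y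
no-gain {x} {y} {d} le s≤d = +-cancelʳ-≤ d x y (≤-trans le (+-monoʳ-≤ y s≤d))

net-loss : ∀ {x y d} → x + d ≤ y → 1 ≤ d → x + 1 ≤ y
net-loss le 1≤d = ≤-trans (+-monoʳ-≤ _ 1≤d) le

drop-surplus : ∀ {x y s} → x ≤ y + s → s ≡ 0 → x ≤ y
drop-surplus {y = y} le refl = ≤-trans le (≤-reflexive (+-identityʳ y))

-- The alternating pattern

parity : ℕ → Fin 3
parity zero = 0F
parity (suc zero) = 1F
parity (suc (suc k)) = parity k

parity-double : ∀ i → parity (i + i) ≡ 0F
parity-double zero = refl
parity-double (suc i) rewrite +-suc i i = parity-double i

parity-suc-double : ∀ i → parity (suc (i + i)) ≡ 1F
parity-suc-double zero = refl
parity-suc-double (suc i) rewrite +-suc i i = parity-suc-double i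

parity≢2 : ∀ k → parity k ≢ 2F
parity≢2 (suc (suc k)) = parity≢2 k

parity-adjacent : ∀ b α → 𝟙 (parity b Fin.≟ α) + 𝟙 (parity (suc b) Fin.≟ α) ≤ 1
parity-adjacent zero 0F = ≤-refl
parity-adjacent zero 1F = ≤-refl
parity-adjacent zero 2F = z≤n
parity-adjacent (suc zero) 0F = ≤-refl
parity-adjacent (suc zero) 1F = ≤-refl
parity-adjacent (suc zero) 2F = z≤n
parity-adjacent (suc (suc b)) α = parity-adjacent b α

parityCount : ℕ → ℕ → Fin 3 → ℕ
parityCount n b α = count n (λ t → parity (toℕ t + b) Fin.≟ α)

twice-parityCount≤ : ∀ n b α →
  2 * parityCount n b α + 𝟙 (parity (n + b) Fin.≟ α) ≤ n + 𝟙 (parity b Fin.≟ α)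
twice-parityCount≤ zero b α = ≤-refl
twice-parityCount≤ (suc zero) b α = begin
  2 * (p + 0) + q ≡⟨ rearrange p q ⟩
  p + (p + q)     ≤⟨ +-monoʳ-≤ p (parity-adjacent b α) ⟩
  p + 1           ≡⟨ +-comm p 1 ⟩
  1 + p           ∎
  where
  open ≤-Reasoning
  p q : ℕ
  p = 𝟙 (parity b Fin.≟ α)
  q = 𝟙 (parity (suc b) Fin.≟ α)
  rearrange : ∀ p q → 2 * (p + 0) + q ≡ p + (p + q)
  rearrange = solve-∀
twice-parityCount≤ (suc (suc n)) b α = begin
  2 * (p + (q + s)) + r     ≡⟨ rearrange p q s r ⟩
  2 * (p + q) + (2 * s + r) ≤⟨ +-mono-≤ (*-monoʳ-≤ 2 (parity-adjacent b α)) (twice-parityCount≤ n b α) ⟩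
  2 + (n + p)               ∎
  where
  open ≤-Reasoning
  p q r s : ℕ
  p = 𝟙 (parity b Fin.≟ α)
  q = 𝟙 (parity (suc b) Fin.≟ α)
  r = 𝟙 (parity (n + b) Fin.≟ α)
  s = parityCount n b α
  rearrange : ∀ p q s r → 2 * (p + (q + s)) + r ≡ 2 * (p + q) + (2 * s + r)
  rearrange = solve-∀

twice-parityCount≤1+n : ∀ n b α → 2 * parityCount n b α ≤ suc n
twice-parityCount≤1+n n b α = +-cancelʳ-≤ f _ _ (begin
  2 * parityCount n b α + f  ≤⟨ twice-parityCount≤ n b α ⟩
  n + 𝟙 (parity b Fin.≟ α)   ≤⟨ +-monoʳ-≤ n (𝟙≤1 _) ⟩
  n + 1                      ≡⟨ +-comm n 1 ⟩
  suc n                      ≤⟨ m≤m+n (suc n) f ⟩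
  suc n + f                  ∎)
  where
  open ≤-Reasoning
  f : ℕ
  f = 𝟙 (parity (n + b) Fin.≟ α)

twice-parityCount≤n : ∀ n b α → 𝟙 (parity b Fin.≟ α) ≤ 𝟙 (parity (n + b) Fin.≟ α) →
                      2 * parityCount n b α ≤ n
twice-parityCount≤n n b α e≤f =
  +-cancelʳ-≤ _ _ _ (≤-trans (twice-parityCount≤ n b α) (+-monoʳ-≤ n e≤f))

-- The colouring and the majority condition

colour : ℕ → ℕ → Fin 3
colour i j with j ≟ i | j ≟ suc i | i ≟ 0 ×-dec j ≟ 2
... | yes _ | _     | _     = 2F
... | no _  | yes _ | _     = 2F
... | no _  | no _  | yes _ = 1F
... | no _  | no _  | no _  = parity (i + j)

colouring : ∀ n → EdgeColoring n 3
colouring n i j = colour (toℕ i) (toℕ j)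

cell-0 : ∀ i j → 𝟙 (colour i j Fin.≟ 0F) + 𝟙 (j ≟ i) ≤ 𝟙 (parity (i + j) Fin.≟ 0F)
cell-0 i j with j ≟ i | j ≟ suc i | i ≟ 0 ×-dec j ≟ 2
... | yes refl | _     | _     rewrite parity-double i = ≤-refl
... | no _     | yes _ | _     = z≤n
... | no _     | no _  | yes _ = z≤n
... | no _     | no _  | no _  = ≤-reflexive (+-identityʳ _)

cell-1 : ∀ i j → 𝟙 (colour i j Fin.≟ 1F) + 𝟙 (j ≟ suc i) ≤
                 𝟙 (parity (i + j) Fin.≟ 1F) + 𝟙 (i ≟ 0 ×-dec j ≟ 2)
cell-1 i j with j ≟ i | j ≟ suc i | i ≟ 0 ×-dec j ≟ 2
... | yes refl | yes i≡1+i | _                 = contradiction (sym i≡1+i) 1+n≢n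
... | yes refl | no _      | _                 = z≤n
... | no _     | yes refl  | _                 rewrite +-suc i i | parity-suc-double i = s≤s z≤n
... | no _     | no _      | yes (refl , refl) = ≤-refl
... | no _     | no _      | no _              = ≤-refl

cell-2 : ∀ i j → 𝟙 (colour i j Fin.≟ 2F) ≤ 𝟙 (j ≟ i) + 𝟙 (j ≟ suc i)
cell-2 i j with j ≟ i | j ≟ suc i | i ≟ 0 ×-dec j ≟ 2
... | yes _ | _     | _     = s≤s z≤n
... | no _  | yes _ | _     = s≤s z≤n
... | no _  | no _  | yes _ = z≤n
... | no _  | no _  | no _  = ≤-reflexive (𝟙-no (parity (i + j) Fin.≟ 2F) (parity≢2 (i + j)))

rowCount colCount : ℕ → ℕ → Fin 3 → ℕ
rowCount n a α = count n (λ t → colour a (toℕ t) Fin.≟ α)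
colCount n b α = count n (λ t → colour (toℕ t) b Fin.≟ α)

module _ (n : ℕ) where

  parityCount-comm : ∀ a α → count n (λ t → parity (a + toℕ t) Fin.≟ α) ≡ parityCount n a α
  parityCount-comm a α = sum-cong-≗ {n} λ t → cong (λ k → 𝟙 (parity k Fin.≟ α)) (+-comm a (toℕ t))

  row-comparison-0 : ∀ a → rowCount n a 0F + count n (λ t → toℕ t ≟ a) ≤ parityCount n a 0F
  row-comparison-0 a = begin
    rowCount n a 0F + count n (λ t → toℕ t ≟ a)   ≤⟨ ∑-mono-+ˡ {n} (λ t → cell-0 a (toℕ t)) ⟩
    count n (λ t → parity (a + toℕ t) Fin.≟ 0F)  ≡⟨ parityCount-comm a 0F ⟩
    parityCount n a 0F                           ∎
    where open ≤-Reasoning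

  row-comparison-1 : ∀ a → rowCount n a 1F + count n (λ t → toℕ t ≟ suc a) ≤
                           parityCount n a 1F + count n (λ t → a ≟ 0 ×-dec toℕ t ≟ 2)
  row-comparison-1 a = begin
    rowCount n a 1F + count n (λ t → toℕ t ≟ suc a)          ≤⟨ ∑-mono-+ {n} (λ t → cell-1 a (toℕ t)) ⟩
    count n (λ t → parity (a + toℕ t) Fin.≟ 1F) + twists     ≡⟨ cong (_+ twists) (parityCount-comm a 1F) ⟩
    parityCount n a 1F + twists                              ∎
    where
    open ≤-Reasoning
    twists : ℕ
    twists = count n (λ t → a ≟ 0 ×-dec toℕ t ≟ 2)

  row-bound-2 : ∀ a → rowCount n a 2F ≤ count n (λ t → toℕ t ≟ a) + count n (λ t → toℕ t ≟ suc a)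
  row-bound-2 a = ∑-mono-+ʳ {n} (λ t → cell-2 a (toℕ t))

  col-comparison-0 : ∀ b → colCount n b 0F + count n (λ t → b ≟ toℕ t) ≤ parityCount n b 0F
  col-comparison-0 b = ∑-mono-+ˡ {n} (λ t → cell-0 (toℕ t) b)

  col-comparison-1 : ∀ b → colCount n b 1F + count n (λ t → b ≟ suc (toℕ t)) ≤
                           parityCount n b 1F + count n (λ t → toℕ t ≟ 0 ×-dec b ≟ 2)
  col-comparison-1 b = ∑-mono-+ {n} (λ t → cell-1 (toℕ t) b)

  col-bound-2 : ∀ b → colCount n b 2F ≤ count n (λ t → b ≟ toℕ t) + count n (λ t → b ≟ suc (toℕ t))
  col-bound-2 b = ∑-mono-+ʳ {n} (λ t → cell-2 (toℕ t) b)

row-majority : ∀ n → 4 ≤ n → ∀ a → a < n → ∀ α → 2 * rowCount n a α ≤ n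
row-majority n _ a a<n 0F = twice≤-by-loss loses-diagonal (twice-parityCount≤1+n n a 0F)
  where
  loses-diagonal : rowCount n a 0F + 1 ≤ parityCount n a 0F
  loses-diagonal = net-loss (row-comparison-0 n a) (count-index n a<n)
row-majority n 4≤n zero _ 1F = twice≤-by-≤ twist-compensates (twice-parityCount≤n n 0 1F z≤n)
  where
  twist-compensates : rowCount n 0 1F ≤ parityCount n 0 1F
  twist-compensates = no-gain (row-comparison-1 n 0) (≤-trans
    (count-pinned n (λ t → 0 ≟ 0 ×-dec toℕ t ≟ 2) 2 (λ (_ , t≡2) → t≡2))
    (count-index n (≤-trans (s≤s (s≤s z≤n)) 4≤n)))
row-majority n _ (suc a) a<n 1F = later-row (m≤n⇒m<n∨m≡n a<n)
  where
  no-twists : count n (λ t → suc a ≟ 0 ×-dec toℕ t ≟ 2) ≡ 0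
  no-twists = count-none n (λ t → suc a ≟ 0 ×-dec toℕ t ≟ 2) (λ _ ())
  later-row : suc (suc a) < n ⊎ suc (suc a) ≡ n → 2 * rowCount n (suc a) 1F ≤ n
  later-row (inj₁ 2+a<n) = twice≤-by-loss loses-superdiagonal (twice-parityCount≤1+n n (suc a) 1F)
    where
    loses-superdiagonal : rowCount n (suc a) 1F + 1 ≤ parityCount n (suc a) 1F
    loses-superdiagonal =
      net-loss (drop-surplus (row-comparison-1 n (suc a)) no-twists) (count-index n 2+a<n)
  -- The last row has no superdiagonal cell, but its alternating pattern ends in colour 1.
  later-row (inj₂ 2+a≡n) = twice≤-by-≤ dominated (twice-parityCount≤n n (suc a) 1F ends-odd)
    where
    dominated : rowCount n (suc a) 1F ≤ parityCount n (suc a) 1F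
    dominated = no-gain (row-comparison-1 n (suc a)) (≤-trans (≤-reflexive no-twists) z≤n)
    ends-odd : 𝟙 (parity (suc a) Fin.≟ 1F) ≤ 𝟙 (parity (n + suc a) Fin.≟ 1F)
    ends-odd = ≤-trans (𝟙≤1 _) (≤-reflexive (sym (𝟙-yes (parity (n + suc a) Fin.≟ 1F) (begin
      parity (n + suc a)           ≡⟨ cong (λ m → parity (m + suc a)) 2+a≡n ⟨
      parity (suc (suc a) + suc a) ≡⟨ cong parity (+-suc a a) ⟩
      parity (suc (a + a))         ≡⟨ parity-suc-double a ⟩
      1F                           ∎))))
      where open ≡-Reasoning
row-majority n 4≤n a _ 2F = twice≤-by-≤ on-path 4≤n
  where
  on-path : rowCount n a 2F ≤ 2
  on-path = ≤-trans (row-bound-2 n a)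
    (+-mono-≤ (count-pinned n (λ t → toℕ t ≟ a) a id) (count-pinned n (λ t → toℕ t ≟ suc a) (suc a) id))

col-loses-superdiagonal : ∀ n b → suc b ≢ 2 → suc b < n →
                          colCount n (suc b) 1F + 1 ≤ parityCount n (suc b) 1F
col-loses-superdiagonal n b 1+b≢2 1+b<n = net-loss
  (drop-surplus (col-comparison-1 n (suc b))
    (count-none n (λ t → toℕ t ≟ 0 ×-dec suc b ≟ 2) λ _ (_ , 1+b≡2) → 1+b≢2 1+b≡2))
  (count-some n (λ t → suc b ≟ suc (toℕ t)) (cong suc (sym (Fin.toℕ-fromℕ< (<-trans (n<1+n b) 1+b<n)))))

col-majority : ∀ n → 4 ≤ n → ∀ b → b < n → ∀ α → 2 * colCount n b α ≤ n
col-majority n _ b b<n 0F = twice≤-by-loss loses-diagonal (twice-parityCount≤1+n n b 0F)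
  where
  loses-diagonal : colCount n b 0F + 1 ≤ parityCount n b 0F
  loses-diagonal = net-loss (col-comparison-0 n b) (count-some n (λ t → b ≟ toℕ t) (sym (Fin.toℕ-fromℕ< b<n)))
col-majority n _ zero _ 1F = twice≤-by-≤ dominated (twice-parityCount≤n n 0 1F z≤n)
  where
  dominated : colCount n 0 1F ≤ parityCount n 0 1F
  dominated = no-gain (col-comparison-1 n 0)
    (≤-trans (≤-reflexive (count-none n (λ t → toℕ t ≟ 0 ×-dec 0 ≟ 2) λ _ → λ { (_ , ()) })) z≤n)
col-majority n _ (suc zero) 1<n 1F =
  twice≤-by-loss (col-loses-superdiagonal n 0 (λ ()) 1<n) (twice-parityCount≤1+n n 1 1F)
col-majority n 4≤n (suc (suc zero)) _ 1F = twice≤-by-≤ twist-compensates (twice-parityCount≤n n 2 1F z≤n)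
  where
  twist-compensates : colCount n 2 1F ≤ parityCount n 2 1F
  twist-compensates = no-gain (col-comparison-1 n 2) (≤-trans
    (count-pinned n (λ t → toℕ t ≟ 0 ×-dec 2 ≟ 2) 0 (λ (t≡0 , _) → t≡0))
    (count-some n (λ t → 2 ≟ suc (toℕ t)) (cong suc (sym (Fin.toℕ-fromℕ< (≤-trans (s≤s (s≤s z≤n)) 4≤n))))))
col-majority n _ (suc (suc (suc b))) 3+b<n 1F =
  twice≤-by-loss (col-loses-superdiagonal n (suc (suc b)) (λ ()) 3+b<n) (twice-parityCount≤1+n n (3 + b) 1F)
col-majority n 4≤n b _ 2F = twice≤-by-≤ on-path 4≤n
  where
  on-path : colCount n b 2F ≤ 2
  on-path = ≤-trans (col-bound-2 n b) (+-mono-≤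
    (count-pinned n (λ t → b ≟ toℕ t) b sym)
    (count-pinned n (λ t → b ≟ suc (toℕ t)) (b ∸ 1) (λ b≡1+t → cong (_∸ 1) (sym b≡1+t))))

colouring-majority : ∀ {n} → 4 ≤ n → IsMajority (colouring n)
colouring-majority {n} 4≤n (inj₁ i) α =
  subst (λ k → 2 * k ≤ n) (sym (length-filter-tabulate (λ j → colouring n i j Fin.≟ α) id))
    (row-majority n 4≤n (toℕ i) (Fin.toℕ<n i) α)
colouring-majority {n} 4≤n (inj₂ j) α =
  subst (λ k → 2 * k ≤ n) (sym (length-filter-tabulate (λ i → colouring n i j Fin.≟ α) id))
    (col-majority n 4≤n (toℕ j) (Fin.toℕ<n j) α)

-- Rigidity of paths

module Path {V : Set} (Step : V → V → Set) (pos : V → ℕ)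
  (pos-injective : ∀ {u v} → pos u ≡ pos v → u ≡ v)
  (pos-step : ∀ {u v} → Step u v → pos v ≡ suc (pos u))
  (predecessor : ∀ {v k} → pos v ≡ suc k → Σ V λ u → Step u v) where

  Link : V → V → Set
  Link u v = Step u v ⊎ Step v u

  Endpoint : V → Set
  Endpoint v = ∀ {a b} → Link v a → Link v b → a ≡ b

  link-pos : ∀ {u v} → Link u v → pos v ≡ suc (pos u) ⊎ pos u ≡ suc (pos v)
  link-pos (inj₁ u→v) = inj₁ (pos-step u→v)
  link-pos (inj₂ v→u) = inj₂ (pos-step v→u)

  pos-pred : ∀ {u v k} → Step u v → pos v ≡ suc k → pos u ≡ k
  pos-pred u→v e = suc-injective (trans (sym (pos-step u→v)) e)

  start-or-predecessor : ∀ v → pos v ≡ 0 ⊎ Σ V λ u → Step u v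
  start-or-predecessor v with pos v in e
  ... | zero  = inj₁ refl
  ... | suc _ = inj₂ (predecessor e)

  inner-not-endpoint : ∀ {u v w} → Step u v → Step v w → ¬ Endpoint v
  inner-not-endpoint {u} {v} {w} u→v v→w end = m≢1+n+m (pos u) {1} (begin
    pos u             ≡⟨ cong pos (end (inj₂ u→v) (inj₁ v→w)) ⟩
    pos w             ≡⟨ pos-step v→w ⟩
    suc (pos v)       ≡⟨ cong suc (pos-step u→v) ⟩
    suc (suc (pos u)) ∎)
    where open ≡-Reasoning

  endpoint-image : ∀ {φ ψ : V → V} → (∀ v → φ (ψ v) ≡ v) → (∀ {u v} → Link (φ u) (φ v) → Link u v) →
                   ∀ {v} → Endpoint v → Endpoint (φ v)
  endpoint-image {φ} {ψ} φψ reflects {v} end {a} {b} va vb = begin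
    a       ≡⟨ φψ a ⟨
    φ (ψ a) ≡⟨ cong φ (end (pull va) (pull vb)) ⟩
    φ (ψ b) ≡⟨ φψ b ⟩
    b       ∎
    where
    open ≡-Reasoning
    pull : ∀ {c} → Link (φ v) c → Link v (ψ c)
    pull {c} vc = reflects (subst (Link (φ v)) (sym (φψ c)) vc)

  module _ {φ : V → V} (φ-injective : ∀ {u v} → φ u ≡ φ v → u ≡ v)
           (φ-link : ∀ {u v} → Link u v → Link (φ u) (φ v))
           {s : V} (s-start : pos s ≡ 0) (φs≡s : φ s ≡ s) where

    private
      pos-fixed : ∀ k {v} → pos v ≡ k → pos (φ v) ≡ k
      no-backtrack : ∀ k {u v} → Step u v → pos v ≡ suc k → pos (φ u) ≡ k → pos (φ u) ≢ suc (pos (φ v))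

      pos-fixed zero {v} e = begin
        pos (φ v) ≡⟨ cong (pos ∘ φ) (pos-injective (trans e (sym s-start))) ⟩
        pos (φ s) ≡⟨ cong pos φs≡s ⟩
        pos s     ≡⟨ s-start ⟩
        0         ∎
        where open ≡-Reasoning
      pos-fixed (suc k) e with predecessor e
      ... | u , u→v with link-pos (φ-link (inj₁ u→v)) | pos-fixed k (pos-pred u→v e)
      ...   | inj₁ forward  | φu≡k = trans forward (cong suc φu≡k)
      ...   | inj₂ backward | φu≡k = contradiction backward (no-backtrack k u→v e φu≡k)

      -- If φ v preceded φ u it would sit at the position of φ w, w the predecessor of u; injectivity gives v ≡ w.
      no-backtrack zero _ _ φu≡0 back = 0≢1+n (trans (sym φu≡0) back)
      no-backtrack (suc k) {u} {v} u→v e φu≡1+k back with predecessor (pos-pred u→v e)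
      ... | w , w→u = m≢1+n+m k {1} (begin
        k           ≡⟨ pos-pred w→u (pos-pred u→v e) ⟨
        pos w       ≡⟨ cong pos (φ-injective (pos-injective (trans φw≡k (sym φv≡k)))) ⟩
        pos v       ≡⟨ e ⟩
        suc (suc k) ∎)
        where
        open ≡-Reasoning
        φv≡k : pos (φ v) ≡ k
        φv≡k = suc-injective (trans (sym back) φu≡1+k)
        φw≡k : pos (φ w) ≡ k
        φw≡k = pos-fixed k (pos-pred w→u (pos-pred u→v e))

    fix-start⇒fix-all : ∀ v → φ v ≡ v
    fix-start⇒fix-all v = pos-injective (pos-fixed (pos v) refl)

-- The colour-2 path in K_{n,n}

-- The path R₀ → L₀ → R₁ → L₁ → ⋯, with pos giving the position along it.
data Step {n : ℕ} : Vertex n → Vertex n → Set where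
  cross : ∀ {i j} → toℕ i ≡ toℕ j → Step (inj₂ j) (inj₁ i)
  climb : ∀ {i j} → toℕ j ≡ suc (toℕ i) → Step (inj₁ i) (inj₂ j)

pos : ∀ {n} → Vertex n → ℕ
pos (inj₁ i) = suc (2 * toℕ i)
pos (inj₂ j) = 2 * toℕ j

pos-injective : ∀ {n} {u v : Vertex n} → pos u ≡ pos v → u ≡ v
pos-injective {u = inj₁ i} {inj₁ i′} e = cong inj₁ (Fin.toℕ-injective (*-cancelˡ-≡ _ _ 2 (suc-injective e)))
pos-injective {u = inj₁ i} {inj₂ j}  e = contradiction (sym e) (even≢odd (toℕ j) (toℕ i))
pos-injective {u = inj₂ j} {inj₁ i}  e = contradiction e (even≢odd (toℕ j) (toℕ i))
pos-injective {u = inj₂ j} {inj₂ j′} e = cong inj₂ (Fin.toℕ-injective (*-cancelˡ-≡ _ _ 2 e))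

pos-step : ∀ {n} {u v : Vertex n} → Step u v → pos v ≡ suc (pos u)
pos-step (cross e) = cong (suc ∘ (2 *_)) e
pos-step {u = inj₁ i} (climb e) = trans (cong (2 *_) e) (*-suc 2 (toℕ i))

predecessor : ∀ {n} {v : Vertex n} {k} → pos v ≡ suc k → Σ (Vertex n) λ u → Step u v
predecessor {v = inj₁ i} _ = inj₂ i , cross refl
predecessor {v = inj₂ fzero} ()
predecessor {v = inj₂ (fsuc j)} _ = inj₁ (inject₁ j) , climb (cong suc (sym (Fin.toℕ-inject₁ j)))

module _ {n : ℕ} where
  open Path (Step {n}) pos pos-injective pos-step predecessor public

start : ∀ {n} → Vertex (suc n)
start = inj₂ fzero

start-endpoint : ∀ {n} → Endpoint (start {n})
start-endpoint sa sb = trans (only-link sa) (sym (only-link sb))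
  where
  only-link : ∀ {c} → Link start c → c ≡ inj₁ fzero
  only-link {inj₁ _} (inj₁ (cross e)) = cong inj₁ (Fin.toℕ-injective e)
  only-link {inj₁ _} (inj₂ (climb ()))
  only-link {inj₂ _} (inj₁ ())
  only-link {inj₂ _} (inj₂ ())

flip : ∀ {n} → Vertex n → Vertex n
flip (inj₁ i) = inj₂ (opposite i)
flip (inj₂ j) = inj₁ (opposite j)

flip-involutive : ∀ {n} (v : Vertex n) → flip (flip v) ≡ v
flip-involutive (inj₁ i) = cong inj₁ (Fin.opposite-involutive i)
flip-involutive (inj₂ j) = cong inj₂ (Fin.opposite-involutive j)

flip-injective : ∀ {n} {u v : Vertex n} → flip u ≡ flip v → u ≡ v
flip-injective {u = u} {v} e = trans (sym (flip-involutive u)) (trans (cong flip e) (flip-involutive v))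

opposite-climb : ∀ {n} {i j : Fin n} → toℕ j ≡ suc (toℕ i) → toℕ (opposite i) ≡ suc (toℕ (opposite j))
opposite-climb {n} {i} {j} e = begin
  toℕ (opposite i)          ≡⟨ Fin.opposite-prop i ⟩
  suc n ∸ suc (suc (toℕ i)) ≡⟨ cong (λ k → suc n ∸ suc k) e ⟨
  suc n ∸ suc (toℕ j)       ≡⟨ +-∸-assoc 1 (Fin.toℕ<n j) ⟩
  suc (n ∸ suc (toℕ j))     ≡⟨ cong suc (Fin.opposite-prop j) ⟨
  suc (toℕ (opposite j))    ∎
  where open ≡-Reasoning

flip-step : ∀ {n} {u v : Vertex n} → Step u v → Step (flip v) (flip u)
flip-step (cross e) = cross (cong (toℕ ∘ opposite) (Fin.toℕ-injective (sym e)))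
flip-step (climb e) = climb (opposite-climb e)

flip-link : ∀ {n} {u v : Vertex n} → Link u v → Link (flip u) (flip v)
flip-link (inj₁ u→v) = inj₂ (flip-step u→v)
flip-link (inj₂ v→u) = inj₁ (flip-step v→u)

endpoints : ∀ {n} {v : Vertex (suc n)} → Endpoint v → v ≡ start ⊎ v ≡ flip start
endpoints {v = v} end with start-or-predecessor v | start-or-predecessor (flip v)
... | inj₁ v-start | _ = inj₁ (pos-injective v-start)
... | inj₂ _ | inj₁ flip-v-start =
  inj₂ (trans (sym (flip-involutive v)) (cong flip (pos-injective {v = start} flip-v-start)))
... | inj₂ (u , u→v) | inj₂ (w , w→flip-v) =
  ⊥-elim (inner-not-endpoint u→v (subst (λ x → Step x (flip w)) (flip-involutive v) (flip-step w→flip-v)) end)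

-- Colour-preserving automorphisms

colour≡2⇔ : ∀ i j → colour i j ≡ 2F ⇔ (j ≡ i ⊎ j ≡ suc i)
colour≡2⇔ i j with j ≟ i | j ≟ suc i | i ≟ 0 ×-dec j ≟ 2
... | yes j≡i | _         | _     = mk⇔ (λ _ → inj₁ j≡i) (λ _ → refl)
... | no _    | yes j≡1+i | _     = mk⇔ (λ _ → inj₂ j≡1+i) (λ _ → refl)
... | no j≢i  | no j≢1+i  | yes _ = mk⇔ (λ ()) (⊥-elim ∘ [ j≢i , j≢1+i ])
... | no j≢i  | no j≢1+i  | no _  = mk⇔ (⊥-elim ∘ parity≢2 (i + j)) (⊥-elim ∘ [ j≢i , j≢1+i ])

link-left-right : ∀ {n} {i j : Fin n} → Link (inj₁ i) (inj₂ j) ⇔ (toℕ j ≡ toℕ i ⊎ toℕ j ≡ suc (toℕ i))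
link-left-right {i = i} {j} = mk⇔ to from
  where
  to : Link (inj₁ i) (inj₂ j) → toℕ j ≡ toℕ i ⊎ toℕ j ≡ suc (toℕ i)
  to (inj₁ (climb e)) = inj₂ e
  to (inj₂ (cross e)) = inj₁ (sym e)
  from : toℕ j ≡ toℕ i ⊎ toℕ j ≡ suc (toℕ i) → Link (inj₁ i) (inj₂ j)
  from (inj₁ e) = inj₂ (cross (sym e))
  from (inj₂ e) = inj₁ (climb e)

link⇔colour≡2 : ∀ {n} {u v : Vertex n} (e : Adj u v) → Link u v ⇔ colorOf (colouring n) u v e ≡ 2F
link⇔colour≡2 (lr i j) = ⇔.trans link-left-right (⇔.sym (colour≡2⇔ (toℕ i) (toℕ j)))
link⇔colour≡2 (rl i j) = ⇔.trans (mk⇔ swap swap) (link⇔colour≡2 (lr i j))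

link⇒adj : ∀ {n} {u v : Vertex n} → Link u v → Adj u v
link⇒adj (inj₁ (cross _)) = rl _ _
link⇒adj (inj₁ (climb _)) = lr _ _
link⇒adj (inj₂ (cross _)) = lr _ _
link⇒adj (inj₂ (climb _)) = rl _ _

colorOf-right-left : ∀ {n k} (c : EdgeColoring n k) {u v i j} (e : Adj u v) →
                     u ≡ inj₂ j → v ≡ inj₁ i → colorOf c u v e ≡ c i j
colorOf-right-left c (rl i j) refl refl = refl

-- In K_{4+m,4+m} the reversal maps the twisted edge L₀R₂ to L_{m+1}R_{m+3}.
colour-reflected-twist : ∀ m → colour (suc m) (3 + m) ≡ 0F
colour-reflected-twist m with 3 + m ≟ suc m | 3 + m ≟ suc (suc m) | suc m ≟ 0 ×-dec 3 + m ≟ 2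
... | yes 3+m≡1+m | _           | _ = contradiction (sym 3+m≡1+m) (m≢1+n+m (suc m) {1})
... | no _        | yes 3+m≡2+m | _ = contradiction 3+m≡2+m 1+n≢n
... | no _        | no _        | yes (() , _)
... | no _        | no _        | no _ = trans (cong parity (rearrange m)) (parity-double m)
  where
  rearrange : ∀ m → suc m + (3 + m) ≡ 4 + (m + m)
  rearrange = solve-∀

module ColourPreserving (m : ℕ) (a : Automorphism (4 + m)) (pc : PreservesColoring (colouring (4 + m)) a) where
  open Automorphism a

  preserves-link : ∀ {u v} → Link u v → Link (φ u) (φ v)
  preserves-link {u} {v} l = Equivalence.from (link⇔colour≡2 (preserves e))
    (trans (pc u v e) (Equivalence.to (link⇔colour≡2 e) l))
    where
    e : Adj u v
    e = link⇒adj l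

  reflects-link : ∀ {u v} → Link (φ u) (φ v) → Link u v
  reflects-link {u} {v} l = Equivalence.from (link⇔colour≡2 e)
    (trans (sym (pc u v e)) (Equivalence.to (link⇔colour≡2 (preserves e)) l))
    where
    e : Adj u v
    e = reflects (link⇒adj l)

  φ-injective : ∀ {u v} → φ u ≡ φ v → u ≡ v
  φ-injective = Injection.injective (↔⇒↣ perm)

  not-flip : ¬ (∀ v → φ v ≡ flip v)
  not-flip φ≡flip = Fin.0≢1+n (begin
    0F                                            ≡⟨ colour-reflected-twist m ⟨
    colour (suc m) (3 + m)                        ≡⟨ cong₂ colour (Fin.opposite-prop {4 + m} 2F)
                                                                  (Fin.opposite-prop {4 + m} 0F) ⟨
    colouring (4 + m) (opposite 2F) (opposite 0F) ≡⟨ colorOf-right-left (colouring (4 + m))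
                                                       (preserves (lr 0F 2F)) (φ≡flip _) (φ≡flip _) ⟨
    colorOf (colouring (4 + m)) (φ (inj₁ 0F)) (φ (inj₂ 2F)) (preserves (lr 0F 2F))
                                                  ≡⟨ pc (inj₁ 0F) (inj₂ 2F) (lr 0F 2F) ⟩
    1F                                            ∎)
    where open ≡-Reasoning

  is-identity : ∀ v → φ v ≡ v
  is-identity with endpoints (endpoint-image (Inverse.strictlyInverseˡ perm) reflects-link start-endpoint)
  ... | inj₁ φs≡s = fix-start⇒fix-all φ-injective preserves-link refl φs≡s
  ... | inj₂ φs≡flip-s = ⊥-elim (not-flip φ≡flip)
    where
    flip∘φ-fixes : ∀ v → flip (φ v) ≡ v
    flip∘φ-fixes = fix-start⇒fix-all (φ-injective ∘ flip-injective) (flip-link ∘ preserves-link) refl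
      (trans (cong flip φs≡flip-s) (flip-involutive start))
    φ≡flip : ∀ v → φ v ≡ flip v
    φ≡flip v = trans (sym (flip-involutive (φ v))) (cong flip (flip∘φ-fixes v))

colouring-distinguishing : ∀ m → IsDistinguishing (colouring (4 + m))
colouring-distinguishing = ColourPreserving.is-identity

corollary14 : (n : ℕ) → 4 ≤ n →
    Σ ℕ (λ k → k ≤ 3 × Σ (EdgeColoring n k) (λ c → IsMajority c × IsDistinguishing c))
corollary14 n@(suc (suc (suc (suc m)))) 4≤n@(s≤s (s≤s (s≤s (s≤s _)))) =
  3 , ≤-refl , colouring n , colouring-majority 4≤n , colouring-distinguishing m
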